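{- Let $G$ and $G'$ be two graphs on the same vertex set $V$ (possibly infinite), and let $k$ be an integer with $k\geq 5$, $k\equiv 1\pmod 4$, and $k\leq |V|-2$ (void if $V$ is infinite). Then the following are equivalent: (i) for every $k$-element subset $K$ of $V$, $e(G_{\restriction K})$ and $e(G'_{\restriction K})$ have the same parity, and $G$ and $G'$ have the same $3$-homogeneous subsets; (ii) $G'=G$ or $G'=\overline G$.
   Context: A graph is a pair $G=(V,E)$ with $E$ a set of 2-element subsets of $V$; $\overline G$ is its complement, $G_{\restriction K}$ the subgraph induced on $K$, and $e(H)$ the number of edges of $H$. A triangle of $G$ is a 3-element subset of $V$ all of whose pairs are edges of $G$; a $3$-homogeneous subset of $G$ is a 3-element subset of $V$ that is a triangle of $G$ or of $\overline G$. -}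

module Defs where

open import Data.Bool using (Bool; true; false; not)
open import Data.Nat using (ℕ; zero; suc; _+_; _%_)
open import Data.Fin using (Fin; zero; suc)
open import Data.Product using (Σ; _×_; _,_; proj₁)
open import Data.Sum using (_⊎_)
open import Relation.Binary.PropositionalEquality using (_≡_; _≢_; refl; cong)
open import Function using (_∘_; _⇔_)
open import Function.Definitions using (Injective)

-- Edges are 2-element subsets, so only the values adj x y with
-- x ≢ y are meaningful; the values adj x x are ignored everywhere below.
record Graph (V : Set) : Set where
  field
    adj : V → V → Bool
    adj-sym : ∀ x y → adj x y ≡ adj y x
open Graph public

compl : {V : Set} → Graph V → Graph V
adj (compl G) x y = not (adj G x y)
adj-sym (compl G) x y = cong not (adj-sym G x y)

KSubset : (V : Set) → ℕ → Set
KSubset V k = Σ (Fin k → V) (λ f → Injective _≡_ _≡_ f)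

countAdj : {V : Set} → Graph V → V → {k : ℕ} → (Fin k → V) → ℕ
countAdj G v {zero} g = 0
countAdj G v {suc k} g with adj G v (g zero)
... | true  = suc (countAdj G v (g ∘ suc))
... | false = countAdj G v (g ∘ suc)

edgesOn : {V : Set} → Graph V → {k : ℕ} → (Fin k → V) → ℕ
edgesOn G {zero} f = 0
edgesOn G {suc k} f = countAdj G (f zero) (f ∘ suc) + edgesOn G (f ∘ suc)

e↾ : {V : Set} → Graph V → {k : ℕ} → KSubset V k → ℕ
e↾ G (f , _) = edgesOn G f

Triangle : {V : Set} → Graph V → V → V → V → Set
Triangle G x y z = (adj G x y ≡ true) × (adj G y z ≡ true) × (adj G x z ≡ true)

Homogeneous3 : {V : Set} → Graph V → V → V → V → Set
Homogeneous3 G x y z = Triangle G x y z ⊎ Triangle (compl G) x y z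

Distinct3 : {V : Set} → V → V → V → Set
Distinct3 x y z = (x ≢ y) × (y ≢ z) × (x ≢ z)

SameHom3 : {V : Set} → Graph V → Graph V → Set
SameHom3 {V} G G' = ∀ (x y z : V) → Distinct3 x y z →
  (Homogeneous3 G x y z ⇔ Homogeneous3 G' x y z)

SameGraph : {V : Set} → Graph V → Graph V → Set
SameGraph {V} G G' = ∀ (x y : V) → x ≢ y → adj G' x y ≡ adj G x y

AtLeast : (V : Set) → ℕ → Set
AtLeast V n = KSubset V n

module Submission where

-- Let D be the symmetric difference of G and G′; the claim is that D is empty or complete.
-- Equal parities of e(G↾K) and e(G′↾K) say that every k-set spans an even number of edges
-- of D.  Reading this on the k-sets {a, b} ∪ L for a fixed (k−2)-set L shows that, off L,
-- D is a cut (complete bipartite between two sides), possibly complemented; in particular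
-- D(x,u) + D(x,w) mod 2 does not depend on x.  Equal 3-homogeneous sets forbid a vertex joined
-- in one colour of D to a triangle of the other colour.  These two facts force D to be constant.
-- Conversely, e(G̅↾K) = C(k,2) − e(G↾K), and C(k,2) is even when k ≡ 1 (mod 4).


open import Defs
open import Data.Nat using (ℕ; _≤_; _+_; _%_)
open import Data.Sum using (_⊎_)
open import Relation.Binary.PropositionalEquality using (_≡_)
open import Data.Product using (_×_)
open import Function using (_⇔_)

open import Algebra.Bundles using (CommutativeRing)
import Algebra.Properties.CommutativeSemigroup as CommutativeSemigroupProperties
open import Data.Bool using (Bool; true; false; not; _xor_; if_then_else_)
open import Data.Bool.Properties
  using (_≟_; xor-assoc; xor-comm; xor-same; xor-inverseˡ; not-involutive; not-injective;
         not-distribˡ-xor; xor-annihilates-not; ¬-not; not-¬; xor-∧-commutativeRing)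
open import Data.Empty using (⊥; ⊥-elim)
open import Data.Fin using (Fin; zero; suc; punchIn)
open import Data.Fin.Properties using (0≢1+n; suc-injective; punchIn-injective; punchInᵢ≢i)
open import Data.List using (List; []; _∷_; length)
open import Data.List.Relation.Unary.All as All using (All; []; _∷_)
open import Data.Nat using (zero; suc; s≤s; z≤n)
open import Data.Nat.Combinatorics using (_C_; nC1≡n; nCk+nC[k+1]≡[n+1]C[k+1])
open import Data.Nat.DivMod using (%-remove-+ˡ)
open import Data.Nat.Divisibility using (∣-refl)
import Data.Nat.Properties as ℕ
open import Data.Product using (Σ; _,_; proj₁; proj₂)
open import Data.Sum using (inj₁; inj₂; [_,_]′)
import Data.Sum as Sum
open import Data.Vec.Functional using () renaming (_∷_ to _∷ᶠ_)
open import Effect.Monad using (RawMonad)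
open import Level using (0ℓ)
open import Function using (_∘_; mk⇔; Equivalence)
open import Function.Construct.Composition using (_⇔-∘_)
import Function.Construct.Composition as Compose
open import Function.Construct.Symmetry using (⇔-sym)
open import Function.Definitions using (Injective)
open import Relation.Binary.PropositionalEquality
  using (_≢_; refl; sym; trans; cong; cong₂; subst; ≢-sym; module ≡-Reasoning)
open import Relation.Nullary using (¬_; Dec; yes; no)
open import Relation.Nullary.Decidable using (decidable-stable; ¬¬-excluded-middle)
open import Relation.Nullary.Negation using (¬¬-Monad)

open CommutativeRing xor-∧-commutativeRing using (+-commutativeSemigroup)
open CommutativeSemigroupProperties +-commutativeSemigroup
  using () renaming (interchange to xor-interchange)
open CommutativeSemigroupProperties ℕ.+-commutativeSemigroup
  using () renaming (interchange to +-interchange)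
open RawMonad (¬¬-Monad {0ℓ}) using (_>>=_; pure)
open ≡-Reasoning

xor≡false⇒≡ : ∀ {x y} → x xor y ≡ false → x ≡ y
xor≡false⇒≡ {false} {false} _ = refl
xor≡false⇒≡ {true}  {true}  _ = refl

≡⇒xor≡false : ∀ {x y} → x ≡ y → x xor y ≡ false
≡⇒xor≡false {x} refl = xor-same x

≢⇒xor≡true : ∀ {x y} → x ≢ y → x xor y ≡ true
≢⇒xor≡true {x} {y} x≢y = trans (cong (_xor y) (¬-not x≢y)) (xor-inverseˡ y)

xor-cancelˡ : ∀ z {x y} → z xor x ≡ z xor y → x ≡ y
xor-cancelˡ false eq = eq
xor-cancelˡ true  eq = not-injective eq

xor-cancelʳ : ∀ z {x y} → x xor z ≡ y xor z → x ≡ y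
xor-cancelʳ z {x} {y} eq = xor-cancelˡ z (trans (xor-comm z x) (trans eq (xor-comm y z)))

xor-cancel-common : ∀ z x y → (z xor x) xor (z xor y) ≡ x xor y
xor-cancel-common z x y = trans (xor-interchange z x z y) (cong (_xor (x xor y)) (xor-same z))

≢-transport : ∀ {x y x′ y′} → x xor y ≡ x′ xor y′ → x ≢ y → x′ ≢ y′
≢-transport eq x≢y x′≡y′ = x≢y (xor≡false⇒≡ (trans eq (≡⇒xor≡false x′≡y′)))

≢-≢⇒≡ : ∀ {x y z : Bool} → x ≢ y → y ≢ z → x ≡ z
≢-≢⇒≡ x≢y y≢z = trans (¬-not x≢y) (sym (¬-not (≢-sym y≢z)))

xor-solve : ∀ {x y z} → x xor y ≡ z → y ≡ z xor x
xor-solve {false} {false} refl = refl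
xor-solve {false} {true}  refl = refl
xor-solve {true}  {false} refl = refl
xor-solve {true}  {true}  refl = refl

≡-equivalent⇒xor≡ : ∀ {x y x′ y′ : Bool} → (x ≡ y → x′ ≡ y′) → (x′ ≡ y′ → x ≡ y) → x xor x′ ≡ y xor y′
≡-equivalent⇒xor≡ {x} {y} {x′} {y′} to from with x ≟ y
... | yes x≡y = cong₂ _xor_ x≡y (to x≡y)
... | no  x≢y = trans (cong₂ _xor_ (¬-not x≢y) (¬-not (x≢y ∘ from))) (xor-annihilates-not y y′)

xor-xor-same : ∀ {x y} z → x ≡ y → x xor (y xor z) ≡ z
xor-xor-same {x} z refl = trans (sym (xor-assoc x x z)) (cong (_xor z) (xor-same x))

xor-xor-differ : ∀ {x y} z → x ≢ y → x xor (y xor z) ≡ not z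
xor-xor-differ {x} {y} z x≢y = trans (sym (xor-assoc x y z)) (cong (_xor z) (≢⇒xor≡true x≢y))

bool-pigeonhole : ∀ (x y z : Bool) → x ≡ y ⊎ x ≡ z ⊎ y ≡ z
bool-pigeonhole false false _     = inj₁ refl
bool-pigeonhole true  true  _     = inj₁ refl
bool-pigeonhole false true  false = inj₂ (inj₁ refl)
bool-pigeonhole false true  true  = inj₂ (inj₂ refl)
bool-pigeonhole true  false true  = inj₂ (inj₁ refl)
bool-pigeonhole true  false false = inj₂ (inj₂ refl)

odd : ℕ → Bool
odd zero    = false
odd (suc n) = not (odd n)

odd-+ : ∀ m n → odd (m + n) ≡ odd m xor odd n
odd-+ zero    n = refl
odd-+ (suc m) n = trans (cong not (odd-+ m n)) (not-distribˡ-xor (odd m) (odd n))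

%2≡if-odd : ∀ n → n % 2 ≡ (if odd n then 1 else 0)
%2≡if-odd zero          = refl
%2≡if-odd (suc zero)    = refl
%2≡if-odd (suc (suc n)) = begin
  (2 + n) % 2                         ≡⟨ %-remove-+ˡ n ∣-refl ⟩
  n % 2                               ≡⟨ %2≡if-odd n ⟩
  (if odd n then 1 else 0)            ≡⟨ cong (λ b → if b then 1 else 0) (sym (not-involutive (odd n))) ⟩
  (if odd (suc (suc n)) then 1 else 0) ∎

odd≡⇒%2≡ : ∀ {m n} → odd m ≡ odd n → m % 2 ≡ n % 2
odd≡⇒%2≡ {m} {n} eq =
  trans (%2≡if-odd m) (trans (cong (λ b → if b then 1 else 0) eq) (sym (%2≡if-odd n)))

%2≡⇒odd≡ : ∀ {m n} → m % 2 ≡ n % 2 → odd m ≡ odd n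
%2≡⇒odd≡ {m} {n} eq = indicator-injective (trans (sym (%2≡if-odd m)) (trans eq (%2≡if-odd n)))
  where
  indicator-injective : ∀ {a b} → (if a then 1 else 0) ≡ (if b then 1 else 0) → a ≡ b
  indicator-injective {false} {false} _ = refl
  indicator-injective {true}  {true}  _ = refl

odd-sucC2 : ∀ n → odd (suc n C 2) ≡ odd n xor odd (n C 2)
odd-sucC2 n = begin
  odd (suc n C 2)             ≡⟨ cong odd (sym (nCk+nC[k+1]≡[n+1]C[k+1] n 1)) ⟩
  odd (n C 1 + n C 2)         ≡⟨ odd-+ (n C 1) (n C 2) ⟩
  odd (n C 1) xor odd (n C 2) ≡⟨ cong (λ i → odd i xor odd (n C 2)) (nC1≡n n) ⟩
  odd n xor odd (n C 2)       ∎

odd-2+C2 : ∀ n → odd ((2 + n) C 2) ≡ not (odd (n C 2))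
odd-2+C2 n = begin
  odd ((2 + n) C 2)                         ≡⟨ odd-sucC2 (suc n) ⟩
  not (odd n) xor odd (suc n C 2)           ≡⟨ cong (not (odd n) xor_) (odd-sucC2 n) ⟩
  not (odd n) xor (odd n xor odd (n C 2))   ≡⟨ xor-assoc (not (odd n)) (odd n) (odd (n C 2)) ⟨
  (not (odd n) xor odd n) xor odd (n C 2)   ≡⟨ cong (_xor odd (n C 2)) (xor-inverseˡ (odd n)) ⟩
  not (odd (n C 2))                         ∎

even-C2 : ∀ k → k % 4 ≡ 1 → odd (k C 2) ≡ false
even-C2 (suc zero)                _     = refl
even-C2 (suc (suc (suc (suc n)))) k%4≡1 = begin
  odd ((4 + n) C 2)         ≡⟨ odd-2+C2 (2 + n) ⟩
  not (odd ((2 + n) C 2))   ≡⟨ cong not (odd-2+C2 n) ⟩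
  not (not (odd (n C 2)))   ≡⟨ not-involutive (odd (n C 2)) ⟩
  odd (n C 2)               ≡⟨ even-C2 n (trans (sym (%-remove-+ˡ n ∣-refl)) k%4≡1) ⟩
  false                     ∎

SameParity : {V : Set} → ℕ → Graph V → Graph V → Set
SameParity {V} k G G′ = (K : KSubset V k) → e↾ G K % 2 ≡ e↾ G′ K % 2

module _ {V : Set} where

  symDiff : Graph V → Graph V → Graph V
  adj (symDiff G G′) x y = adj G x y xor adj G′ x y
  adj-sym (symDiff G G′) x y = cong₂ _xor_ (adj-sym G x y) (adj-sym G′ x y)

  Outside : ∀ {n} → (Fin n → V) → V → Set
  Outside f v = ∀ i → f i ≢ v

  cons-injective : ∀ {n} {x : V} {f : Fin n → V} →
    Injective _≡_ _≡_ f → Outside f x → Injective _≡_ _≡_ (x ∷ᶠ f)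
  cons-injective f-inj x∉f {zero}  {zero}  _  = refl
  cons-injective f-inj x∉f {zero}  {suc j} eq = ⊥-elim (x∉f j (sym eq))
  cons-injective f-inj x∉f {suc i} {zero}  eq = ⊥-elim (x∉f i eq)
  cons-injective f-inj x∉f {suc i} {suc j} eq = cong suc (f-inj eq)

  odd-countAdj-suc : ∀ (G : Graph V) v {n} (f : Fin (suc n) → V) →
    odd (countAdj G v f) ≡ adj G v (f zero) xor odd (countAdj G v (f ∘ suc))
  odd-countAdj-suc G v f with adj G v (f zero)
  ... | true  = refl
  ... | false = refl

  odd-edgesOn-suc : ∀ (G : Graph V) {n} (f : Fin (suc n) → V) →
    odd (edgesOn G f) ≡ odd (countAdj G (f zero) (f ∘ suc)) xor odd (edgesOn G (f ∘ suc))
  odd-edgesOn-suc G f = odd-+ (countAdj G (f zero) (f ∘ suc)) (edgesOn G (f ∘ suc))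

  odd-edgesOn-∷∷ : ∀ (G : Graph V) a b {n} (L : Fin n → V) →
    odd (edgesOn G (a ∷ᶠ b ∷ᶠ L))
      ≡ (adj G a b xor odd (countAdj G a L)) xor (odd (countAdj G b L) xor odd (edgesOn G L))
  odd-edgesOn-∷∷ G a b L =
    trans (odd-edgesOn-suc G (a ∷ᶠ b ∷ᶠ L))
          (cong₂ _xor_ (odd-countAdj-suc G a (b ∷ᶠ L)) (odd-edgesOn-suc G (b ∷ᶠ L)))

  odd-countAdj-symDiff : ∀ (G G′ : Graph V) v {n} (f : Fin n → V) →
    odd (countAdj (symDiff G G′) v f) ≡ odd (countAdj G v f) xor odd (countAdj G′ v f)
  odd-countAdj-symDiff G G′ v {zero}  f = refl
  odd-countAdj-symDiff G G′ v {suc n} f = begin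
    odd (countAdj (symDiff G G′) v f)
      ≡⟨ odd-countAdj-suc (symDiff G G′) v f ⟩
    (g xor g′) xor odd (countAdj (symDiff G G′) v (f ∘ suc))
      ≡⟨ cong ((g xor g′) xor_) (odd-countAdj-symDiff G G′ v (f ∘ suc)) ⟩
    (g xor g′) xor (c xor c′)
      ≡⟨ xor-interchange g g′ c c′ ⟩
    (g xor c) xor (g′ xor c′)
      ≡⟨ sym (cong₂ _xor_ (odd-countAdj-suc G v f) (odd-countAdj-suc G′ v f)) ⟩
    odd (countAdj G v f) xor odd (countAdj G′ v f) ∎
    where
    g = adj G v (f zero)
    g′ = adj G′ v (f zero)
    c = odd (countAdj G v (f ∘ suc))
    c′ = odd (countAdj G′ v (f ∘ suc))

  odd-edgesOn-symDiff : ∀ (G G′ : Graph V) {n} (f : Fin n → V) →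
    odd (edgesOn (symDiff G G′) f) ≡ odd (edgesOn G f) xor odd (edgesOn G′ f)
  odd-edgesOn-symDiff G G′ {zero}  f = refl
  odd-edgesOn-symDiff G G′ {suc n} f = begin
    odd (edgesOn (symDiff G G′) f)
      ≡⟨ odd-edgesOn-suc (symDiff G G′) f ⟩
    odd (countAdj (symDiff G G′) (f zero) (f ∘ suc)) xor odd (edgesOn (symDiff G G′) (f ∘ suc))
      ≡⟨ cong₂ _xor_ (odd-countAdj-symDiff G G′ (f zero) (f ∘ suc)) (odd-edgesOn-symDiff G G′ (f ∘ suc)) ⟩
    (c xor c′) xor (e xor e′)
      ≡⟨ xor-interchange c c′ e e′ ⟩
    (c xor e) xor (c′ xor e′)
      ≡⟨ sym (cong₂ _xor_ (odd-edgesOn-suc G f) (odd-edgesOn-suc G′ f)) ⟩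
    odd (edgesOn G f) xor odd (edgesOn G′ f) ∎
    where
    c = odd (countAdj G (f zero) (f ∘ suc))
    c′ = odd (countAdj G′ (f zero) (f ∘ suc))
    e = odd (edgesOn G (f ∘ suc))
    e′ = odd (edgesOn G′ (f ∘ suc))

  countAdj-cong : ∀ {G G′ : Graph V} v {n} (f : Fin n → V) →
    (∀ i → adj G′ v (f i) ≡ adj G v (f i)) → countAdj G′ v f ≡ countAdj G v f
  countAdj-cong v {zero} f _ = refl
  countAdj-cong {G} {G′} v {suc n} f agree rewrite agree zero with adj G v (f zero)
  ... | true  = cong suc (countAdj-cong v (f ∘ suc) (agree ∘ suc))
  ... | false = countAdj-cong v (f ∘ suc) (agree ∘ suc)

  edgesOn-cong : ∀ {G G′ : Graph V} → SameGraph G G′ →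
    ∀ {n} (f : Fin n → V) → Injective _≡_ _≡_ f → edgesOn G′ f ≡ edgesOn G f
  edgesOn-cong same {zero}  f _     = refl
  edgesOn-cong same {suc n} f f-inj = cong₂ _+_
    (countAdj-cong (f zero) (f ∘ suc) (λ i → same (f zero) (f (suc i)) (0≢1+n ∘ f-inj)))
    (edgesOn-cong same (f ∘ suc) (suc-injective ∘ f-inj))

  countAdj-compl : ∀ (G : Graph V) v {n} (f : Fin n → V) → countAdj (compl G) v f + countAdj G v f ≡ n
  countAdj-compl G v {zero}  f = refl
  countAdj-compl G v {suc n} f with adj G v (f zero)
  ... | true  = trans (ℕ.+-suc _ _) (cong suc (countAdj-compl G v (f ∘ suc)))
  ... | false = cong suc (countAdj-compl G v (f ∘ suc))

  edgesOn-compl : ∀ (G : Graph V) {n} (f : Fin n → V) → edgesOn (compl G) f + edgesOn G f ≡ n C 2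
  edgesOn-compl G {zero}  f = refl
  edgesOn-compl G {suc n} f = begin
    (c′ + e′) + (c + e)  ≡⟨ +-interchange c′ e′ c e ⟩
    (c′ + c) + (e′ + e)  ≡⟨ cong₂ _+_ (countAdj-compl G (f zero) (f ∘ suc)) (edgesOn-compl G (f ∘ suc)) ⟩
    n + n C 2            ≡⟨ cong (_+ n C 2) (sym (nC1≡n n)) ⟩
    n C 1 + n C 2        ≡⟨ nCk+nC[k+1]≡[n+1]C[k+1] n 1 ⟩
    suc n C 2            ∎
    where
    c′ = countAdj (compl G) (f zero) (f ∘ suc)
    e′ = edgesOn (compl G) (f ∘ suc)
    c = countAdj G (f zero) (f ∘ suc)
    e = edgesOn G (f ∘ suc)

  Triangle-cong : ∀ {G G′ : Graph V} {x y z} →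
    adj G x y ≡ adj G′ x y → adj G y z ≡ adj G′ y z → adj G x z ≡ adj G′ x z →
    Triangle G x y z → Triangle G′ x y z
  Triangle-cong xy yz xz (t-xy , t-yz , t-xz) = trans (sym xy) t-xy , trans (sym yz) t-yz , trans (sym xz) t-xz

  Homogeneous3-cong : ∀ {G G′ : Graph V} {x y z} →
    adj G x y ≡ adj G′ x y → adj G y z ≡ adj G′ y z → adj G x z ≡ adj G′ x z →
    Homogeneous3 G x y z → Homogeneous3 G′ x y z
  Homogeneous3-cong {G} {G′} xy yz xz = Sum.map
    (Triangle-cong {G} {G′} xy yz xz)
    (Triangle-cong {compl G} {compl G′} (cong not xy) (cong not yz) (cong not xz))

  homogeneous3⇔ : ∀ {G : Graph V} {x y z} →
    Homogeneous3 G x y z ⇔ (adj G x y ≡ adj G y z × adj G x y ≡ adj G x z)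
  homogeneous3⇔ = mk⇔ to from
    where
    to : ∀ {a b c} → (a ≡ true × b ≡ true × c ≡ true) ⊎ (not a ≡ true × not b ≡ true × not c ≡ true) →
      a ≡ b × a ≡ c
    to (inj₁ (a , b , c)) = trans a (sym b) , trans a (sym c)
    to (inj₂ (a , b , c)) = not-injective (trans a (sym b)) , not-injective (trans a (sym c))
    from : ∀ {a b c} → a ≡ b × a ≡ c →
      (a ≡ true × b ≡ true × c ≡ true) ⊎ (not a ≡ true × not b ≡ true × not c ≡ true)
    from {true}  (refl , refl) = inj₁ (refl , refl , refl)
    from {false} (refl , refl) = inj₂ (refl , refl , refl)

  sameGraph⇒sameHom3 : ∀ {G G′ : Graph V} → SameGraph G G′ → SameHom3 G G′
  sameGraph⇒sameHom3 {G} {G′} same x y z (x≢y , y≢z , x≢z) = mk⇔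
    (Homogeneous3-cong {G} {G′} (sym (same x y x≢y)) (sym (same y z y≢z)) (sym (same x z x≢z)))
    (Homogeneous3-cong {G′} {G} (same x y x≢y) (same y z y≢z) (same x z x≢z))

  sameHom3-compl : ∀ {G : Graph V} → SameHom3 G (compl G)
  sameHom3-compl {G} x y z _ = mk⇔
    [ inj₂ ∘ Triangle-cong {G} {compl (compl G)} (sym involutive) (sym involutive) (sym involutive) , inj₁ ]′
    [ inj₂ , inj₁ ∘ Triangle-cong {compl (compl G)} {G} involutive involutive involutive ]′
    where
    involutive : ∀ {u v} → adj (compl (compl G)) u v ≡ adj G u v
    involutive = not-involutive _

  sameGraph⇒sameParity : ∀ {G G′ : Graph V} {k} → SameGraph G G′ → SameParity k G G′
  sameGraph⇒sameParity same (f , f-inj) = cong (_% 2) (sym (edgesOn-cong same f f-inj))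

  sameParity-compl : ∀ {G : Graph V} {k} → k % 4 ≡ 1 → SameParity k G (compl G)
  sameParity-compl {G} {k} k%4≡1 (f , _) = odd≡⇒%2≡ {edgesOn G f} {edgesOn (compl G) f} (sym (xor≡false⇒≡ (begin
    odd (edgesOn (compl G) f) xor odd (edgesOn G f) ≡⟨ odd-+ (edgesOn (compl G) f) (edgesOn G f) ⟨
    odd (edgesOn (compl G) f + edgesOn G f)         ≡⟨ cong odd (edgesOn-compl G f) ⟩
    odd (k C 2)                                     ≡⟨ even-C2 k k%4≡1 ⟩
    false                                           ∎)))

  sameGraph⊎compl⇒sameParity×sameHom3 : ∀ {G G′ : Graph V} {k} → k % 4 ≡ 1 →
    SameGraph G G′ ⊎ SameGraph (compl G) G′ → SameParity k G G′ × SameHom3 G G′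
  sameGraph⊎compl⇒sameParity×sameHom3 {G} {G′} _ (inj₁ same) =
    sameGraph⇒sameParity {G} {G′} same , sameGraph⇒sameHom3 {G} {G′} same
  sameGraph⊎compl⇒sameParity×sameHom3 {G} {G′} k%4≡1 (inj₂ same) =
    (λ K → trans (sameParity-compl {G} k%4≡1 K) (sameGraph⇒sameParity {compl G} {G′} same K)) ,
    (λ x y z distinct →
      sameGraph⇒sameHom3 {compl G} {G′} same x y z distinct ⇔-∘ sameHom3-compl {G} x y z distinct)

  -- Equality on V is not decidable, so vertices avoiding given ones exist only under double
  -- negation; this suffices because they are only used to prove ⊥ or equalities of booleans.
  ¬¬-remove : ∀ {n} (g : Fin (suc n) → V) → Injective _≡_ _≡_ g → (v : V) →
    ¬ ¬ (Σ (Fin n → Fin (suc n)) λ σ → Injective _≡_ _≡_ σ × Outside (g ∘ σ) v)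
  ¬¬-remove {n} g g-inj v = do
    hit? ← ¬¬-excluded-middle {A = Σ (Fin (suc n)) λ j → g j ≡ v}
    pure (remove hit?)
    where
    remove : Dec (Σ (Fin (suc n)) λ j → g j ≡ v) →
      Σ (Fin n → Fin (suc n)) λ σ → Injective _≡_ _≡_ σ × Outside (g ∘ σ) v
    remove (yes (j , gj≡v)) =
      punchIn j , punchIn-injective j _ _ , λ i g[σi]≡v → punchInᵢ≢i j i (g-inj (trans g[σi]≡v (sym gj≡v)))
    remove (no ∄j) = suc , suc-injective , λ i g[1+i]≡v → ∄j (suc i , g[1+i]≡v)

  ¬¬-subenumeration : (vs : List V) {n : ℕ} (g : Fin (length vs + n) → V) → Injective _≡_ _≡_ g →
    ¬ ¬ (Σ (Fin n → Fin (length vs + n)) λ σ → Injective _≡_ _≡_ σ × All (Outside (g ∘ σ)) vs)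
  ¬¬-subenumeration []       g _     = pure ((λ i → i) , (λ {_} {_} eq → eq) , [])
  ¬¬-subenumeration (v ∷ vs) g g-inj = do
    (σ , σ-inj , g∘σ∌v) ← ¬¬-remove g g-inj v
    (τ , τ-inj , g∘σ∘τ∌vs) ← ¬¬-subenumeration vs (g ∘ σ) (Compose.injective _≡_ _≡_ _≡_ σ-inj g-inj)
    pure (σ ∘ τ , (λ {_} {_} → Compose.injective _≡_ _≡_ _≡_ τ-inj σ-inj) , g∘σ∌v ∘ τ ∷ g∘σ∘τ∌vs)

  ¬¬-subsetAvoiding : (vs : List V) {n : ℕ} → KSubset V (length vs + n) →
    ¬ ¬ (Σ (KSubset V n) λ L → All (Outside (proj₁ L)) vs)
  ¬¬-subsetAvoiding vs (g , g-inj) = do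
    (σ , σ-inj , g∘σ∌vs) ← ¬¬-subenumeration vs g g-inj
    pure ((g ∘ σ , λ {_} {_} → Compose.injective _≡_ _≡_ _≡_ σ-inj g-inj) , g∘σ∌vs)

  ¬¬-fresh : (vs : List V) {n : ℕ} → KSubset V (length vs + suc n) → ¬ ¬ (Σ V λ w → All (w ≢_) vs)
  ¬¬-fresh vs K = do
    ((L , _) , L∌vs) ← ¬¬-subsetAvoiding vs K
    pure (L zero , All.map (λ L∌v → L∌v zero) L∌vs)

  constant-difference : ∀ {G G′ : Graph V} (β : Bool) →
    (∀ x y → x ≢ y → adj G′ x y ≡ β xor adj G x y) → SameGraph G G′ ⊎ SameGraph (compl G) G′
  constant-difference false differ = inj₁ differ
  constant-difference true  differ = inj₂ differ

module Reconstruction {V : Set} (G G′ : Graph V) where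

  D : Graph V
  D = symDiff G G′

  module _ (hom : SameHom3 G G′) where

    -- If G agreed on xy and xz then so would G′, and homogeneity of {x, y, z} would give
    -- adj G x y ≡ adj G y z ⇔ adj G′ x y ≡ adj G′ y z, that is, D x y ≡ D y z.
    isosceles-apex : ∀ {x y z w} → Distinct3 x y z →
      adj D x y ≡ w → adj D x z ≡ w → adj D y z ≢ w → adj G x y ≢ adj G x z
    isosceles-apex {x} {y} {z} {w} distinct xy≡w xz≡w yz≢w a≡c =
      yz≢w (trans (sym xy≡yz) xy≡w)
      where
      a′≡c′ : adj G′ x y ≡ adj G′ x z
      a′≡c′ = xor-cancelˡ (adj G x y) (trans (trans xy≡w (sym xz≡w)) (cong (_xor adj G′ x z) (sym a≡c)))
      homogeneous⇔ : (adj G x y ≡ adj G y z × adj G x y ≡ adj G x z)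
                   ⇔ (adj G′ x y ≡ adj G′ y z × adj G′ x y ≡ adj G′ x z)
      homogeneous⇔ = homogeneous3⇔ {G = G′} ⇔-∘ (hom x y z distinct ⇔-∘ ⇔-sym (homogeneous3⇔ {G = G}))
      to : adj G x y ≡ adj G y z → adj G′ x y ≡ adj G′ y z
      to a≡b = proj₁ (Equivalence.to homogeneous⇔ (a≡b , a≡c))
      from : adj G′ x y ≡ adj G′ y z → adj G x y ≡ adj G y z
      from a′≡b′ = proj₁ (Equivalence.from homogeneous⇔ (a′≡b′ , a′≡c′))
      xy≡yz : adj D x y ≡ adj D y z
      xy≡yz = ≡-equivalent⇒xor≡ to from

    no-vertex-separates-triangle : ∀ {c x y z w} → Distinct3 x y z → c ≢ x → c ≢ y → c ≢ z →
      adj D x y ≡ w → adj D y z ≡ w → adj D x z ≡ w →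
      adj D c x ≡ not w → adj D c y ≡ not w → adj D c z ≡ not w → ⊥
    no-vertex-separates-triangle {c} {x} {y} {z} (x≢y , y≢z , x≢z) c≢x c≢y c≢z xy yz xz cx cy cz =
      isosceles-apex (c≢x , x≢z , c≢z) cx cz (not-¬ xz) (≢-≢⇒≡ cx≢cy cy≢cz)
      where
      cx≢cy : adj G c x ≢ adj G c y
      cx≢cy = isosceles-apex (c≢x , x≢y , c≢y) cx cy (not-¬ xy)
      cy≢cz : adj G c y ≢ adj G c z
      cy≢cz = isosceles-apex (c≢y , y≢z , c≢z) cy cz (not-¬ yz)

  module _ {m : ℕ} (par : SameParity (3 + m) G G′) where

    even-D : (K : KSubset V (3 + m)) → odd (e↾ D K) ≡ false
    even-D K@(f , _) =
      trans (odd-edgesOn-symDiff G G′ f) (≡⇒xor≡false (%2≡⇒odd≡ {edgesOn G f} {edgesOn G′ f} (par K)))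

    module _ (L : KSubset V (suc m)) where

      -- Off L, D is the complete bipartite graph between the two values of side, complemented
      -- when offset is true.
      side : V → Bool
      side a = odd (countAdj D a (proj₁ L))

      offset : Bool
      offset = odd (edgesOn D (proj₁ L))

      D-cut : ∀ {a b} → a ≢ b → Outside (proj₁ L) a → Outside (proj₁ L) b →
        adj D a b ≡ side a xor (side b xor offset)
      D-cut {a} {b} a≢b L∌a L∌b = xor≡false⇒≡ (begin
        adj D a b xor (side a xor (side b xor offset))  ≡⟨ xor-assoc (adj D a b) (side a) _ ⟨
        (adj D a b xor side a) xor (side b xor offset)  ≡⟨ odd-edgesOn-∷∷ D a b (proj₁ L) ⟨
        odd (edgesOn D (a ∷ᶠ b ∷ᶠ proj₁ L))             ≡⟨ even-D (a ∷ᶠ b ∷ᶠ proj₁ L , a∷b∷L-inj) ⟩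
        false                                          ∎)
        where
        b∷L∌a : Outside (b ∷ᶠ proj₁ L) a
        b∷L∌a zero    = ≢-sym a≢b
        b∷L∌a (suc i) = L∌a i
        a∷b∷L-inj : Injective _≡_ _≡_ (a ∷ᶠ b ∷ᶠ proj₁ L)
        a∷b∷L-inj = cons-injective (cons-injective (proj₂ L) L∌b) b∷L∌a

      D-cut-same : ∀ {a b} → a ≢ b → Outside (proj₁ L) a → Outside (proj₁ L) b →
        side a ≡ side b → adj D a b ≡ offset
      D-cut-same a≢b L∌a L∌b same = trans (D-cut a≢b L∌a L∌b) (xor-xor-same offset same)

      D-cut-differ : ∀ {a b} → a ≢ b → Outside (proj₁ L) a → Outside (proj₁ L) b →
        side a ≢ side b → adj D a b ≡ not offset
      D-cut-differ a≢b L∌a L∌b differ = trans (D-cut a≢b L∌a L∌b) (xor-xor-differ offset differ)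

    no-separated-cut-vertex : SameHom3 G G′ → (L : KSubset V (suc m)) → ∀ {c x y z} → Distinct3 x y z →
      All (Outside (proj₁ L)) (c ∷ x ∷ y ∷ z ∷ []) →
      side L x ≡ side L y → side L x ≡ side L z → side L c ≢ side L x → ⊥
    no-separated-cut-vertex hom L {c} {x} {y} {z} (x≢y , y≢z , x≢z) (L∌c ∷ L∌x ∷ L∌y ∷ L∌z ∷ [])
      sx≡sy sx≡sz sc≢sx =
      no-vertex-separates-triangle hom (x≢y , y≢z , x≢z) c≢x c≢y c≢z
        (D-cut-same L x≢y L∌x L∌y sx≡sy) (D-cut-same L y≢z L∌y L∌z sy≡sz) (D-cut-same L x≢z L∌x L∌z sx≡sz)
        (D-cut-differ L c≢x L∌c L∌x sc≢sx) (D-cut-differ L c≢y L∌c L∌y sc≢sy) (D-cut-differ L c≢z L∌c L∌z sc≢sz)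
      where
      sy≡sz : side L y ≡ side L z
      sy≡sz = trans (sym sx≡sy) sx≡sz
      sc≢sy : side L c ≢ side L y
      sc≢sy sc≡sy = sc≢sx (trans sc≡sy (sym sx≡sy))
      sc≢sz : side L c ≢ side L z
      sc≢sz sc≡sz = sc≢sx (trans sc≡sz (sym sx≡sz))
      c≢x : c ≢ x
      c≢x = sc≢sx ∘ cong (side L)
      c≢y : c ≢ y
      c≢y = sc≢sy ∘ cong (side L)
      c≢z : c ≢ z
      c≢z = sc≢sz ∘ cong (side L)

    module _ (H : KSubset V (5 + m)) where

      D-four-point : ∀ {x y u w} → x ≢ u → x ≢ w → y ≢ u → y ≢ w →
        adj D x u xor adj D x w ≡ adj D y u xor adj D y w
      D-four-point {x} {y} {u} {w} x≢u x≢w y≢u y≢w = decidable-stable (_ ≟ _) λ differ →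
        ¬¬-subsetAvoiding (x ∷ y ∷ u ∷ w ∷ []) H λ where
          (L , L∌x ∷ L∌y ∷ L∌u ∷ L∌w ∷ []) → differ (begin
            adj D x u xor adj D x w
              ≡⟨ cong₂ _xor_ (D-cut L x≢u L∌x L∌u) (D-cut L x≢w L∌x L∌w) ⟩
            (side L x xor (side L u xor offset L)) xor (side L x xor (side L w xor offset L))
              ≡⟨ xor-cancel-common (side L x) _ _ ⟩
            (side L u xor offset L) xor (side L w xor offset L)
              ≡⟨ xor-cancel-common (side L y) _ _ ⟨
            (side L y xor (side L u xor offset L)) xor (side L y xor (side L w xor offset L))
              ≡⟨ cong₂ _xor_ (D-cut L y≢u L∌y L∌u) (D-cut L y≢w L∌y L∌w) ⟨
            adj D y u xor adj D y w
              ∎)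

      module _ (hom : SameHom3 G G′) where

        -- In the cut given by L, p and q lie on one side and b, c on opposite sides, so one of
        -- b, c is alone against a D-uniform triangle.
        no-separated-twins : ∀ {b c p q} → p ≢ b → q ≢ b → p ≢ c → q ≢ c → p ≢ q →
          adj D p b ≡ adj D q b → adj D p b ≢ adj D p c → ⊥
        no-separated-twins {b} {c} {p} {q} p≢b q≢b p≢c q≢c p≢q twins separated =
          ¬¬-subsetAvoiding (b ∷ c ∷ p ∷ q ∷ []) H refute
          where
          refute : Σ (KSubset V (suc m)) (λ L → All (Outside (proj₁ L)) (b ∷ c ∷ p ∷ q ∷ [])) → ⊥
          refute (L , L∌b ∷ L∌c ∷ L∌p ∷ L∌q ∷ []) = refute-classes (side L p ≟ side L b)
            where
            sp≡sq : side L p ≡ side L q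
            sp≡sq = xor-cancelʳ (side L b xor offset L)
              (trans (sym (D-cut L p≢b L∌p L∌b)) (trans twins (D-cut L q≢b L∌q L∌b)))
            sb≢sc : side L b ≢ side L c
            sb≢sc sb≡sc = separated (begin
              adj D p b                             ≡⟨ D-cut L p≢b L∌p L∌b ⟩
              side L p xor (side L b xor offset L)  ≡⟨ cong (λ s → side L p xor (s xor offset L)) sb≡sc ⟩
              side L p xor (side L c xor offset L)  ≡⟨ D-cut L p≢c L∌p L∌c ⟨
              adj D p c                             ∎)
            refute-classes : Dec (side L p ≡ side L b) → ⊥
            refute-classes (yes sp≡sb) =
              no-separated-cut-vertex hom L (≢-sym p≢b , p≢q , ≢-sym q≢b) (L∌c ∷ L∌b ∷ L∌p ∷ L∌q ∷ [])
                (sym sp≡sb) (trans (sym sp≡sb) sp≡sq) (≢-sym sb≢sc)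
            refute-classes (no sp≢sb) =
              no-separated-cut-vertex hom L (≢-sym p≢c , p≢q , ≢-sym q≢c) (L∌b ∷ L∌c ∷ L∌p ∷ L∌q ∷ [])
                (sym sp≡sc) (trans (sym sp≡sc) sp≡sq) sb≢sc
              where
              sp≡sc : side L p ≡ side L c
              sp≡sc = ≢-≢⇒≡ sp≢sb sb≢sc

        -- If D a b ≢ D a c then, by the four-point property, every vertex separates b from c;
        -- among three such vertices two are twins with respect to b.
        D-star-constant : ∀ {a b c} → Distinct3 a b c → adj D a b ≡ adj D a c
        D-star-constant {a} {b} {c} (a≢b , b≢c , a≢c) = decidable-stable (_ ≟ _) λ separated →
          ¬¬-fresh (a ∷ b ∷ c ∷ []) H λ where
            (e , e≢a ∷ e≢b ∷ e≢c ∷ []) → ¬¬-fresh (a ∷ b ∷ c ∷ e ∷ []) H λ where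
              (f , f≢a ∷ f≢b ∷ f≢c ∷ f≢e ∷ []) →
                let e-separated = ≢-transport (D-four-point a≢b a≢c e≢b e≢c) separated
                in [ (λ ab≡eb → no-separated-twins a≢b e≢b a≢c e≢c (≢-sym e≢a) ab≡eb separated)
                   , [ (λ ab≡fb → no-separated-twins a≢b f≢b a≢c f≢c (≢-sym f≢a) ab≡fb separated)
                     , (λ eb≡fb → no-separated-twins e≢b f≢b e≢c f≢c (≢-sym f≢e) eb≡fb e-separated)
                     ]′
                   ]′ (bool-pigeonhole (adj D a b) (adj D e b) (adj D f b))

        D-constant : ∀ {x y p q} → x ≢ y → p ≢ q → adj D x y ≡ adj D p q
        D-constant {x} {y} {p} {q} x≢y p≢q = decidable-stable (_ ≟ _) λ differ →
          ¬¬-fresh (x ∷ y ∷ p ∷ []) H λ where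
            (z , z≢x ∷ z≢y ∷ z≢p ∷ []) → ¬¬-fresh (x ∷ z ∷ p ∷ q ∷ []) H λ where
              (w , w≢x ∷ w≢z ∷ w≢p ∷ w≢q ∷ []) → differ (begin
                adj D x y  ≡⟨ D-star-constant (x≢y , ≢-sym z≢y , ≢-sym z≢x) ⟩
                adj D x z  ≡⟨ adj-sym D x z ⟩
                adj D z x  ≡⟨ D-star-constant (z≢x , ≢-sym w≢x , ≢-sym w≢z) ⟩
                adj D z w  ≡⟨ adj-sym D z w ⟩
                adj D w z  ≡⟨ D-star-constant (w≢z , z≢p , w≢p) ⟩
                adj D w p  ≡⟨ adj-sym D w p ⟩
                adj D p w  ≡⟨ D-star-constant (≢-sym w≢p , w≢q , p≢q) ⟩
                adj D p q  ∎)

        sameGraph⊎compl : SameGraph G G′ ⊎ SameGraph (compl G) G′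
        sameGraph⊎compl = constant-difference {G = G} {G′} (adj D x₀ x₁)
          λ x y x≢y → xor-solve (D-constant x≢y x₀≢x₁)
          where
          x₀ x₁ : V
          x₀ = proj₁ H zero
          x₁ = proj₁ H (suc zero)
          x₀≢x₁ : x₀ ≢ x₁
          x₀≢x₁ = 0≢1+n ∘ proj₂ H

theorem2p12 : (V : Set) (G G' : Graph V) (k : ℕ) →
    5 ≤ k → k % 4 ≡ 1 → AtLeast V (k + 2) →
    (((K : KSubset V k) → e↾ G K % 2 ≡ e↾ G' K % 2) × SameHom3 G G')
    ⇔ (SameGraph G G' ⊎ SameGraph (compl G) G')
theorem2p12 V G G' (suc (suc (suc (suc (suc j))))) (s≤s (s≤s (s≤s (s≤s (s≤s z≤n))))) k%4≡1 V≥k+2 = mk⇔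
  (λ (par , hom) → Reconstruction.sameGraph⊎compl G G' par V≥5+[2+j] hom)
  (sameGraph⊎compl⇒sameParity×sameHom3 k%4≡1)
  where
  V≥5+[2+j] : KSubset V (5 + (2 + j))
  V≥5+[2+j] = subst (λ n → KSubset V (5 + n)) (ℕ.+-comm j 2) V≥k+2
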